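{- Let $A$ be an $\mathbb{F}$-algebra and let $B_0$ and $B_1$ be two finite bases for the identities of $A$. Then there exists a constant $c$ (depending only on $B_0,B_1$) such that for every identity $f$ of $A$, $Q_{B_0}(f)\le c\cdot Q_{B_1}(f)$.
   Context: $\mathbb{F}$ is a field; an $\mathbb{F}$-algebra is an associative algebra over $\mathbb{F}$. $\mathbb{F}\langle X\rangle$ is the free associative algebra of non-commutative polynomials over $\mathbb{F}$ in variables $X=\{x_1,x_2,\dots\}$. $f(x_1,\dots,x_n)$ is an identity of $A$ if $f(a_1,\dots,a_n)=0$ for all $a_i\in A$. A substitution instance of $g(x_1,\dots,x_k)$ is $g(h_1,\dots,h_k)$ with $h_i\in\mathbb{F}\langle X\rangle$. A set $B$ of identities of $A$ is a basis for the identities of $A$ if every identity of $A$ lies in the two-sided ideal generated by finitely many substitution instances of elements of $B$. For $B\subseteq\mathbb{F}\langle X\rangle$, $Q_B(f)$ is the smallest $k$ such that there exist substitution instances $g_1,\dots,g_k$ of polynomials from $B$ with $f\in\langle g_1,\dots,g_k\rangle$ (two-sided ideal). -}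

module Defs where

open import Level using (Level; _⊔_) renaming (suc to lsuc)
open import Algebra.Bundles using (CommutativeRing; Ring)
open import Data.Nat as ℕ using (ℕ; _<_)
open import Data.Fin using (Fin)
open import Data.List using (List; []; _∷_; _++_; map; concatMap; foldr)
open import Data.List.Properties using (≡-dec)
open import Data.List.Membership.Propositional using (_∈_)
open import Data.List.Relation.Unary.All using (All)
open import Data.Product using (Σ; ∃; _×_; _,_)
open import Relation.Nullary using (¬_; yes; no)

record Field (c ℓ : Level) : Set (lsuc (c ⊔ ℓ)) where
  field
    commutativeRing : CommutativeRing c ℓ
  open CommutativeRing commutativeRing public
  field
    0≉1     : ¬ (0# ≈ 1#)
    inverse : ∀ x → ¬ (x ≈ 0#) → Σ Carrier (λ y → (x * y) ≈ 1#)

record FAlgebra {c ℓ} (F : Field c ℓ) (a ℓa : Level) : Set (c ⊔ ℓ ⊔ lsuc (a ⊔ ℓa)) where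
  module F = Field F
  field
    ring : Ring a ℓa
  open Ring ring public
  infixr 7 _·_
  field
    _·_       : F.Carrier → Carrier → Carrier
    ·-cong    : ∀ {α β x y} → α F.≈ β → x ≈ y → (α · x) ≈ (β · y)
    ·-distribʳ : ∀ α β x → ((α F.+ β) · x) ≈ ((α · x) + (β · x))
    ·-distribˡ : ∀ α x y → (α · (x + y)) ≈ ((α · x) + (α · y))
    ·-assoc   : ∀ α β x → ((α F.* β) · x) ≈ (α · (β · x))
    ·-identity : ∀ x → (F.1# · x) ≈ x
    ·-*-assocˡ : ∀ α x y → ((α · x) * y) ≈ (α · (x * y))
    ·-*-assocʳ : ∀ α x y → (x * (α · y)) ≈ (α · (x * y))

-- A polynomial is a finite formal linear combination of words
-- (monomials) in the variables; two polynomials are equal when all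
-- their coefficients agree.

module FreeAlgebra {c ℓ} (F : Field c ℓ) where
  open Field F

  Word : Set
  Word = List ℕ

  Poly : Set c
  Poly = List (Carrier × Word)

  coeff : Poly → Word → Carrier
  coeff []             w = 0#
  coeff ((α , u) ∷ p) w with ≡-dec ℕ._≟_ u w
  ... | yes _ = α + coeff p w
  ... | no  _ = coeff p w

  infix 4 _≈P_
  _≈P_ : Poly → Poly → Set ℓ
  p ≈P q = ∀ w → coeff p w ≈ coeff q w

  0P : Poly
  0P = []

  1P : Poly
  1P = (1# , []) ∷ []

  var : ℕ → Poly
  var i = (1# , i ∷ []) ∷ []

  infixl 6 _+P_
  infixl 7 _*P_
  infixr 7 _·P_

  _+P_ : Poly → Poly → Poly
  _+P_ = _++_

  _·P_ : Carrier → Poly → Poly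
  α ·P p = map (λ { (β , u) → (α * β , u) }) p

  _*P_ : Poly → Poly → Poly
  p *P q = concatMap (λ { (α , u) → map (λ { (β , v) → (α * β , u ++ v) }) q }) p

  sumP : List Poly → Poly
  sumP = foldr _+P_ 0P

  substWord : (ℕ → Poly) → Word → Poly
  substWord σ = foldr (λ i r → σ i *P r) 1P

  subst : (ℕ → Poly) → Poly → Poly
  subst σ p = sumP (map (λ { (α , u) → α ·P substWord σ u }) p)

  SubstInstance : List Poly → Poly → Set (c ⊔ ℓ)
  SubstInstance B g = Σ Poly λ b → b ∈ B × Σ (ℕ → Poly) λ σ → g ≈P subst σ b

  InIdeal : ∀ {k} → (Fin k → Poly) → Poly → Set (c ⊔ ℓ)
  InIdeal {k} gs f =
    Σ (List (Poly × Fin k × Poly)) λ ts →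
      f ≈P sumP (map (λ { (l , i , r) → l *P gs i *P r }) ts)

  GeneratedBy : List Poly → Poly → ℕ → Set (c ⊔ ℓ)
  GeneratedBy B f k =
    Σ (Fin k → Poly) λ gs → ((i : Fin k) → SubstInstance B (gs i)) × InIdeal gs f

  Q_≡ : List Poly → Poly → ℕ → Set (c ⊔ ℓ)
  Q_≡ B f q = GeneratedBy B f q × (∀ j → j < q → ¬ GeneratedBy B f j)

  module _ {a ℓa} (A : FAlgebra F a ℓa) where
    private module A = FAlgebra A

    evalWord : (ℕ → A.Carrier) → Word → A.Carrier
    evalWord ρ = foldr (λ i r → ρ i A.* r) A.1#

    eval : (ℕ → A.Carrier) → Poly → A.Carrier
    eval ρ []             = A.0#
    eval ρ ((α , u) ∷ p) = (α A.· evalWord ρ u) A.+ eval ρ p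

    IsIdentity : Poly → Set (a ⊔ ℓa)
    IsIdentity f = ∀ (ρ : ℕ → A.Carrier) → eval ρ f A.≈ A.0#

    IsBasis : List Poly → Set (c ⊔ ℓ ⊔ a ⊔ ℓa)
    IsBasis B = All IsIdentity B × (∀ f → IsIdentity f → ∃ λ k → GeneratedBy B f k)

module Submission where

-- Let H be the list obtained by writing every b ∈ B₁ (an identity of A,
-- hence generated by B₀) as an element of the ideal spanned by finitely
-- many substitution instances of B₀; we take C = |H|.  If f lies in the
-- ideal of q₁ instances σᵢ(bᵢ) of B₁, then each σᵢ(bᵢ) lies in the ideal
-- of σᵢ(H), so f lies in the ideal of the q₁·|H| instances in the σᵢ(H),
-- and minimality of q₀ gives q₀ ≤ C·q₁.
--
-- Polynomials are lists of coefficient/word pairs compared coefficientwise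
-- (≈P), so the bulk of the file shows that the ring operations and
-- substitution respect ≈P.  The tool is the pairing ⟨φ, p⟩ = Σ α·φ(u) of p
-- with a function φ on words: two polynomials are ≈P iff all their
-- pairings agree (Pairing), and every algebraic law reduces to a law about
-- pairings (Operations).

open import Defs
open import Level using (_⊔_)
open import Data.Nat as ℕ using (ℕ; zero; suc; s≤s)
import Data.Nat.Properties as ℕP
open import Data.Fin as Fin using (Fin)
open import Data.List using (List; []; _∷_; _++_; map; concatMap; length; tabulate; lookup)
open import Data.List.Properties using (≡-dec; ++-assoc; ++-identityʳ; length-++; length-map)
open import Data.List.Membership.Propositional using (_∈_)
open import Data.List.Membership.Propositional.Properties
  using (∈-map⁺; ∈-tabulate⁺; ∈-tabulate⁻; ∈-lookup; ∈-++⁺ˡ; ∈-++⁺ʳ)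
open import Data.List.Relation.Unary.All as All using (All; []; _∷_)
open import Data.List.Relation.Unary.All.Properties using (++⁺; map⁺; tabulate⁺)
open import Data.List.Relation.Unary.Any as Any using (index)
open import Data.List.Relation.Unary.Any.Properties using (lookup-index)
open import Data.Product using (Σ; ∃; _×_; _,_; proj₁; proj₂)
open import Data.Empty using (⊥-elim)
open import Relation.Nullary using (¬_; Dec; yes; no)
import Relation.Binary.PropositionalEquality as ≡

module Pairing {c ℓ} (F : Field c ℓ) where
  open Field F
  open FreeAlgebra F
  open import Algebra.Solver.Ring.NaturalCoefficients.Default commutativeSemiring
    using (solve; _:=_; _:+_; _:*_)
  open import Algebra.Properties.Ring ring using (-‿distribˡ-*)
  open import Algebra.Properties.AbelianGroup +-abelianGroup
    using (⁻¹-∙-comm; ε⁻¹≈ε; x∙y⁻¹≈ε⇒x≈y)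
  open import Relation.Binary.Reasoning.Setoid setoid

  pair : (Word → Carrier) → Poly → Carrier
  pair φ []             = 0#
  pair φ ((α , u) ∷ p) = α * φ u + pair φ p

  pair-congˡ : ∀ {φ ψ} p → (∀ u → φ u ≈ ψ u) → pair φ p ≈ pair ψ p
  pair-congˡ []             φ≈ψ = refl
  pair-congˡ ((α , u) ∷ p) φ≈ψ = +-cong (*-cong refl (φ≈ψ u)) (pair-congˡ p φ≈ψ)

  pair-++ : ∀ φ p q → pair φ (p ++ q) ≈ pair φ p + pair φ q
  pair-++ φ []             q = sym (+-identityˡ _)
  pair-++ φ ((α , u) ∷ p) q = trans (+-cong refl (pair-++ φ p q)) (sym (+-assoc _ _ _))

  pair-·P : ∀ φ α p → pair φ (α ·P p) ≈ α * pair φ p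
  pair-·P φ α []             = sym (zeroʳ α)
  pair-·P φ α ((β , u) ∷ p) = trans (+-cong refl (pair-·P φ α p))
    (solve 4 (λ a b x y → (a :* b) :* x :+ a :* y := a :* (b :* x :+ y)) refl α β (φ u) (pair φ p))

  pair-+ : ∀ φ ψ p → pair (λ u → φ u + ψ u) p ≈ pair φ p + pair ψ p
  pair-+ φ ψ []             = sym (+-identityˡ _)
  pair-+ φ ψ ((α , u) ∷ p) = trans (+-cong refl (pair-+ φ ψ p))
    (solve 5 (λ a x y z w → a :* (x :+ y) :+ (z :+ w) := (a :* x :+ z) :+ (a :* y :+ w))
      refl α (φ u) (ψ u) (pair φ p) (pair ψ p))

  pair-scale : ∀ φ α p → pair (λ u → α * φ u) p ≈ α * pair φ p
  pair-scale φ α []             = sym (zeroʳ α)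
  pair-scale φ α ((β , u) ∷ p) = trans (+-cong refl (pair-scale φ α p))
    (solve 4 (λ a b x y → b :* (a :* x) :+ a :* y := a :* (b :* x :+ y)) refl α β (φ u) (pair φ p))

  pair-zero : ∀ p → pair (λ _ → 0#) p ≈ 0#
  pair-zero []             = refl
  pair-zero ((α , u) ∷ p) = trans (+-cong (zeroʳ α) (pair-zero p)) (+-identityˡ 0#)

  -- p ≋ q: p and q have the same pairing with every function on words.
  -- This is the working equality of the file; it coincides with ≈P.
  infix 4 _≋_
  record _≋_ (p q : Poly) : Set (c ⊔ ℓ) where
    constructor pairs-agree
    field pair-≈ : ∀ φ → pair φ p ≈ pair φ q
  open _≋_ public

  ≋-refl : ∀ {p} → p ≋ p
  ≋-refl = pairs-agree λ φ → refl

  ≋-reflexive : ∀ {p q} → p ≡.≡ q → p ≋ q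
  ≋-reflexive ≡.refl = ≋-refl

  ≋-sym : ∀ {p q} → p ≋ q → q ≋ p
  ≋-sym p≋q = pairs-agree λ φ → sym (pair-≈ p≋q φ)

  ≋-trans : ∀ {p q r} → p ≋ q → q ≋ r → p ≋ r
  ≋-trans p≋q q≋r = pairs-agree λ φ → trans (pair-≈ p≋q φ) (pair-≈ q≋r φ)

  _≟W_ : (u w : Word) → Dec (u ≡.≡ w)
  u ≟W w = ≡-dec ℕ._≟_ u w

  -- A coefficient is the pairing with an indicator function, so ≋ implies ≈P.
  indicator : Word → Word → Carrier
  indicator w u with u ≟W w
  ... | yes _ = 1#
  ... | no  _ = 0#

  coeff-as-pair : ∀ p w → coeff p w ≈ pair (indicator w) p
  coeff-as-pair []             w = refl
  coeff-as-pair ((α , u) ∷ p) w with u ≟W w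
  ... | yes _ = +-cong (sym (*-identityʳ α)) (coeff-as-pair p w)
  ... | no  _ = trans (coeff-as-pair p w) (sym (trans (+-cong (zeroʳ α) refl) (+-identityˡ _)))

  ≋⇒≈P : ∀ {p q} → p ≋ q → p ≈P q
  ≋⇒≈P {p} {q} p≋q w =
    trans (coeff-as-pair p w) (trans (pair-≈ p≋q (indicator w)) (sym (coeff-as-pair q w)))

  -- For the converse, a polynomial all of whose coefficients vanish has
  -- vanishing pairings; this is shown by deleting one word at a time.
  dropWord : Word → Poly → Poly
  dropWord u []             = []
  dropWord u ((β , v) ∷ p) with v ≟W u
  ... | yes _ = dropWord u p
  ... | no  _ = (β , v) ∷ dropWord u p

  pair-split : ∀ φ u p → pair φ p ≈ coeff p u * φ u + pair φ (dropWord u p)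
  pair-split φ u [] = sym (trans (+-identityʳ _) (zeroˡ _))
  pair-split φ u ((β , v) ∷ p) with v ≟W u
  ... | yes ≡.refl = begin
    β * φ v + pair φ p                                        ≈⟨ +-cong refl (pair-split φ v p) ⟩
    β * φ v + (coeff p v * φ v + pair φ (dropWord v p))
      ≈⟨ solve 4 (λ b x k r → b :* x :+ (k :* x :+ r) := (b :+ k) :* x :+ r)
           refl β (φ v) (coeff p v) (pair φ (dropWord v p)) ⟩
    (β + coeff p v) * φ v + pair φ (dropWord v p)             ∎
  ... | no _ = begin
    β * φ v + pair φ p                                        ≈⟨ +-cong refl (pair-split φ u p) ⟩
    β * φ v + (coeff p u * φ u + pair φ (dropWord u p))
      ≈⟨ solve 4 (λ b x k r → b :+ (k :* x :+ r) := k :* x :+ (b :+ r))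
           refl (β * φ v) (φ u) (coeff p u) (pair φ (dropWord u p)) ⟩
    coeff p u * φ u + (β * φ v + pair φ (dropWord u p))       ∎

  coeff-dropWord-self : ∀ u p → coeff (dropWord u p) u ≈ 0#
  coeff-dropWord-self u []             = refl
  coeff-dropWord-self u ((β , v) ∷ p) with v ≟W u
  ... | yes _ = coeff-dropWord-self u p
  ... | no v≢u with v ≟W u
  ...   | yes v≡u = ⊥-elim (v≢u v≡u)
  ...   | no  _   = coeff-dropWord-self u p

  coeff-dropWord-other : ∀ u w p → ¬ u ≡.≡ w → coeff (dropWord u p) w ≈ coeff p w
  coeff-dropWord-other u w []             u≢w = refl
  coeff-dropWord-other u w ((β , v) ∷ p) u≢w with v ≟W u
  ... | yes ≡.refl with v ≟W w
  ...   | yes v≡w = ⊥-elim (u≢w v≡w)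
  ...   | no  _   = coeff-dropWord-other v w p u≢w
  coeff-dropWord-other u w ((β , v) ∷ p) u≢w | no _ with v ≟W w
  ...   | yes _ = +-cong refl (coeff-dropWord-other u w p u≢w)
  ...   | no  _ = coeff-dropWord-other u w p u≢w

  length-dropWord : ∀ u p → length (dropWord u p) ℕ.≤ length p
  length-dropWord u []             = ℕ.z≤n
  length-dropWord u ((β , v) ∷ p) with v ≟W u
  ... | yes _ = ℕP.m≤n⇒m≤1+n (length-dropWord u p)
  ... | no  _ = s≤s (length-dropWord u p)

  dropWord-head-shorter : ∀ α u p → length (dropWord u ((α , u) ∷ p)) ℕ.≤ length p
  dropWord-head-shorter α u p with u ≟W u
  ... | yes _   = length-dropWord u p
  ... | no u≢u = ⊥-elim (u≢u ≡.refl)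

  -- Induction on a bound n for the length of the polynomial.
  pair-vanishing : ∀ φ n p → length p ℕ.≤ n → (∀ w → coeff p w ≈ 0#) → pair φ p ≈ 0#
  pair-vanishing φ n       []                  _           _     = refl
  pair-vanishing φ (suc n) p@((α , u) ∷ p′) (s≤s |p′|≤n) coeffs≈0 = begin
    pair φ p                                 ≈⟨ pair-split φ u p ⟩
    coeff p u * φ u + pair φ (dropWord u p)
      ≈⟨ +-cong (*-cong (coeffs≈0 u) refl)
           (pair-vanishing φ n (dropWord u p) (ℕP.≤-trans (dropWord-head-shorter α u p′) |p′|≤n)
             dropped≈0) ⟩
    0# * φ u + 0#                            ≈⟨ trans (+-identityʳ _) (zeroˡ _) ⟩
    0#                                       ∎
    where
    dropped≈0 : ∀ w → coeff (dropWord u p) w ≈ 0#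
    dropped≈0 w with u ≟W w
    ... | yes ≡.refl = coeff-dropWord-self u p
    ... | no u≢w     = trans (coeff-dropWord-other u w p u≢w) (coeffs≈0 w)

  negP : Poly → Poly
  negP []             = []
  negP ((β , v) ∷ q) = (- β , v) ∷ negP q

  pair-negP : ∀ φ q → pair φ (negP q) ≈ - pair φ q
  pair-negP φ []             = sym ε⁻¹≈ε
  pair-negP φ ((β , v) ∷ q) =
    trans (+-cong (sym (-‿distribˡ-* β (φ v))) (pair-negP φ q)) (⁻¹-∙-comm _ _)

  coeff-++ : ∀ p q w → coeff (p ++ q) w ≈ coeff p w + coeff q w
  coeff-++ p q w = begin
    coeff (p ++ q) w                                 ≈⟨ coeff-as-pair (p ++ q) w ⟩
    pair (indicator w) (p ++ q)                      ≈⟨ pair-++ (indicator w) p q ⟩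
    pair (indicator w) p + pair (indicator w) q      ≈⟨ sym (+-cong (coeff-as-pair p w) (coeff-as-pair q w)) ⟩
    coeff p w + coeff q w                            ∎

  coeff-negP : ∀ q w → coeff (negP q) w ≈ - coeff q w
  coeff-negP q w = trans (coeff-as-pair (negP q) w)
    (trans (pair-negP (indicator w) q) (-‿cong (sym (coeff-as-pair q w))))

  -- If p ≈P q then p − q has zero coefficients, hence zero pairings.
  ≈P⇒≋ : ∀ {p q} → p ≈P q → p ≋ q
  ≈P⇒≋ {p} {q} p≈q = pairs-agree λ φ → x∙y⁻¹≈ε⇒x≈y _ _ (begin
    pair φ p + - pair φ q      ≈⟨ sym (trans (pair-++ φ p (negP q)) (+-cong refl (pair-negP φ q))) ⟩
    pair φ (p ++ negP q)       ≈⟨ pair-vanishing φ _ (p ++ negP q) ℕP.≤-refl difference≈0 ⟩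
    0#                         ∎)
    where
    difference≈0 : ∀ w → coeff (p ++ negP q) w ≈ 0#
    difference≈0 w = begin
      coeff (p ++ negP q) w          ≈⟨ coeff-++ p (negP q) w ⟩
      coeff p w + coeff (negP q) w   ≈⟨ +-cong (p≈q w) (coeff-negP q w) ⟩
      coeff q w + - coeff q w        ≈⟨ -‿inverseʳ _ ⟩
      0#                             ∎

-- Products and substitutions, computed on pairings: pairing with a product
-- is an iterated pairing, and pairing with a substitution instance is a
-- pairing with substituted words.
module Operations {c ℓ} (F : Field c ℓ) where
  open Field F
  open FreeAlgebra F
  open Pairing F
  open import Algebra.Solver.Ring.NaturalCoefficients.Default commutativeSemiring
    using (solve; _:=_; _:+_; _:*_)
  open import Relation.Binary.Reasoning.Setoid setoid

  shift : (Word → Carrier) → Word → Word → Carrier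
  shift φ u v = φ (u ++ v)

  -- One row α·u · q of a product, given through any map g that acts like
  -- the (anonymous) term multiplication used in _*P_.
  pair-row : ∀ φ α u q (g : Carrier × Word → Carrier × Word) →
    (∀ β v → g (β , v) ≡.≡ (α * β , u ++ v)) →
    pair φ (map g q) ≈ α * pair (shift φ u) q
  pair-row φ α u []             g g-row = sym (zeroʳ α)
  pair-row φ α u ((β , v) ∷ q) g g-row rewrite g-row β v =
    trans (+-cong refl (pair-row φ α u q g g-row))
      (solve 4 (λ a b x y → (a :* b) :* x :+ a :* y := a :* (b :* x :+ y))
        refl α β (φ (u ++ v)) (pair (shift φ u) q))

  pair-* : ∀ φ p q → pair φ (p *P q) ≈ pair (λ u → pair (shift φ u) q) p
  pair-* φ p q = rows _ (λ α u → pair-row φ α u q _ (λ β v → ≡.refl)) p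
    where
    rows : ∀ (h : Carrier × Word → Poly) →
      (∀ α u → pair φ (h (α , u)) ≈ α * pair (shift φ u) q) →
      ∀ p → pair φ (concatMap h p) ≈ pair (λ u → pair (shift φ u) q) p
    rows h h-row []             = refl
    rows h h-row ((α , u) ∷ p) =
      trans (pair-++ φ (h (α , u)) (concatMap h p)) (+-cong (h-row α u) (rows h h-row p))

  pair-swap : ∀ (G : Word → Word → Carrier) p q →
    pair (λ x → pair (G x) q) p ≈ pair (λ v → pair (λ x → G x v) p) q
  pair-swap G []             q = sym (pair-zero q)
  pair-swap G ((α , u) ∷ p) q = begin
    α * pair (G u) q + pair (λ x → pair (G x) q) p
      ≈⟨ +-cong (sym (pair-scale (G u) α q)) (pair-swap G p q) ⟩
    pair (λ v → α * G u v) q + pair (λ v → pair (λ x → G x v) p) q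
      ≈⟨ sym (pair-+ _ _ q) ⟩
    pair (λ v → α * G u v + pair (λ x → G x v) p) q ∎

  ++-≋ : ∀ {p p′ q q′} → p ≋ p′ → q ≋ q′ → p ++ q ≋ p′ ++ q′
  ++-≋ {p} {p′} {q} {q′} p≋p′ q≋q′ = pairs-agree λ φ →
    trans (pair-++ φ p q) (trans (+-cong (pair-≈ p≋p′ φ) (pair-≈ q≋q′ φ)) (sym (pair-++ φ p′ q′)))

  *-≋ : ∀ {p p′ q q′} → p ≋ p′ → q ≋ q′ → p *P q ≋ p′ *P q′
  *-≋ {p} {p′} {q} {q′} p≋p′ q≋q′ = pairs-agree λ φ → begin
    pair φ (p *P q)                          ≈⟨ pair-* φ p q ⟩
    pair (λ u → pair (shift φ u) q) p        ≈⟨ pair-congˡ p (λ u → pair-≈ q≋q′ (shift φ u)) ⟩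
    pair (λ u → pair (shift φ u) q′) p       ≈⟨ pair-≈ p≋p′ _ ⟩
    pair (λ u → pair (shift φ u) q′) p′      ≈⟨ sym (pair-* φ p′ q′) ⟩
    pair φ (p′ *P q′)                        ∎

  *-assoc-≋ : ∀ p q r → (p *P q) *P r ≋ p *P (q *P r)
  *-assoc-≋ p q r = pairs-agree λ φ → begin
    pair φ ((p *P q) *P r)                                      ≈⟨ pair-* φ (p *P q) r ⟩
    pair (λ x → pair (shift φ x) r) (p *P q)                    ≈⟨ pair-* _ p q ⟩
    pair (λ u → pair (λ v → pair (shift φ (u ++ v)) r) q) p
      ≈⟨ pair-congˡ p (λ u → pair-congˡ q (λ v → pair-congˡ r (λ z →
           reflexive (≡.cong φ (++-assoc u v z))))) ⟩
    pair (λ u → pair (λ v → pair (shift (shift φ u) v) r) q) p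
      ≈⟨ pair-congˡ p (λ u → sym (pair-* (shift φ u) q r)) ⟩
    pair (λ u → pair (shift φ u) (q *P r)) p                    ≈⟨ sym (pair-* φ p (q *P r)) ⟩
    pair φ (p *P (q *P r))                                      ∎

  *-distribˡ-≋ : ∀ p q r → p *P (q ++ r) ≋ p *P q ++ p *P r
  *-distribˡ-≋ p q r = pairs-agree λ φ → begin
    pair φ (p *P (q ++ r))                              ≈⟨ pair-* φ p (q ++ r) ⟩
    pair (λ u → pair (shift φ u) (q ++ r)) p            ≈⟨ pair-congˡ p (λ u → pair-++ _ q r) ⟩
    pair (λ u → pair (shift φ u) q + pair (shift φ u) r) p ≈⟨ pair-+ _ _ p ⟩
    pair (λ u → pair (shift φ u) q) p + pair (λ u → pair (shift φ u) r) p
      ≈⟨ sym (+-cong (pair-* φ p q) (pair-* φ p r)) ⟩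
    pair φ (p *P q) + pair φ (p *P r)                   ≈⟨ sym (pair-++ φ (p *P q) (p *P r)) ⟩
    pair φ (p *P q ++ p *P r)                           ∎

  *-distribʳ-≋ : ∀ p q r → (p ++ q) *P r ≋ p *P r ++ q *P r
  *-distribʳ-≋ p q r = pairs-agree λ φ → begin
    pair φ ((p ++ q) *P r)                ≈⟨ pair-* φ (p ++ q) r ⟩
    pair _ (p ++ q)                       ≈⟨ pair-++ _ p q ⟩
    pair _ p + pair _ q                   ≈⟨ sym (+-cong (pair-* φ p r) (pair-* φ q r)) ⟩
    pair φ (p *P r) + pair φ (q *P r)     ≈⟨ sym (pair-++ φ (p *P r) (q *P r)) ⟩
    pair φ (p *P r ++ q *P r)             ∎

  *-zeroʳ-≋ : ∀ p → p *P [] ≋ []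
  *-zeroʳ-≋ p = pairs-agree λ φ → trans (pair-* φ p []) (pair-zero p)

  pair-subst : ∀ φ σ p → pair φ (subst σ p) ≈ pair (λ u → pair φ (substWord σ u)) p
  pair-subst φ σ []             = refl
  pair-subst φ σ ((α , u) ∷ p) = trans (pair-++ φ (α ·P substWord σ u) (subst σ p))
    (+-cong (pair-·P φ α (substWord σ u)) (pair-subst φ σ p))

  substWord-++ : ∀ σ u v → substWord σ (u ++ v) ≋ substWord σ u *P substWord σ v
  substWord-++ σ []      v = pairs-agree λ φ → sym (trans (pair-* φ (substWord σ []) (substWord σ v))
    (trans (+-identityʳ _) (*-identityˡ _)))
  substWord-++ σ (i ∷ u) v = ≋-trans (*-≋ {p = σ i} ≋-refl (substWord-++ σ u v))
    (≋-sym (*-assoc-≋ (σ i) (substWord σ u) (substWord σ v)))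

  subst-* : ∀ σ p q → subst σ (p *P q) ≋ subst σ p *P subst σ q
  subst-* σ p q = pairs-agree λ φ → begin
    pair φ (subst σ (p *P q))                                    ≈⟨ pair-subst φ σ (p *P q) ⟩
    pair (λ w → pair φ (σ* w)) (p *P q)                          ≈⟨ pair-* _ p q ⟩
    pair (λ u → pair (λ v → pair φ (σ* (u ++ v))) q) p
      ≈⟨ pair-congˡ p (λ u → pair-congˡ q (λ v →
           trans (pair-≈ (substWord-++ σ u v) φ) (pair-* φ (σ* u) (σ* v)))) ⟩
    pair (λ u → pair (λ v → pair (λ x → pair (shift φ x) (σ* v)) (σ* u)) q) p
      ≈⟨ pair-congˡ p (λ u → sym (pair-swap (λ x v → pair (shift φ x) (σ* v)) (σ* u) q)) ⟩
    pair (λ u → pair (λ x → pair (λ v → pair (shift φ x) (σ* v)) q) (σ* u)) p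
      ≈⟨ pair-congˡ p (λ u → pair-congˡ (σ* u) (λ x → sym (pair-subst _ σ q))) ⟩
    pair (λ u → pair (λ x → pair (shift φ x) (subst σ q)) (σ* u)) p
      ≈⟨ sym (pair-subst _ σ p) ⟩
    pair (λ x → pair (shift φ x) (subst σ q)) (subst σ p)       ≈⟨ sym (pair-* φ (subst σ p) (subst σ q)) ⟩
    pair φ (subst σ p *P subst σ q)                              ∎
    where
    σ* : Word → Poly
    σ* = substWord σ

  subst-++ : ∀ σ p q → subst σ (p ++ q) ≋ subst σ p ++ subst σ q
  subst-++ σ p q = pairs-agree λ φ → begin
    pair φ (subst σ (p ++ q))                  ≈⟨ pair-subst φ σ (p ++ q) ⟩
    pair _ (p ++ q)                            ≈⟨ pair-++ _ p q ⟩
    pair _ p + pair _ q                        ≈⟨ sym (+-cong (pair-subst φ σ p) (pair-subst φ σ q)) ⟩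
    pair φ (subst σ p) + pair φ (subst σ q)    ≈⟨ sym (pair-++ φ (subst σ p) (subst σ q)) ⟩
    pair φ (subst σ p ++ subst σ q)            ∎

  subst-≋ : ∀ σ {p q} → p ≋ q → subst σ p ≋ subst σ q
  subst-≋ σ {p} {q} p≋q = pairs-agree λ φ →
    trans (pair-subst φ σ p) (trans (pair-≈ p≋q _) (sym (pair-subst φ σ q)))

  _∘σ_ : (ℕ → Poly) → (ℕ → Poly) → ℕ → Poly
  (σ ∘σ τ) i = subst σ (τ i)

  subst-substWord : ∀ σ τ u → subst σ (substWord τ u) ≋ substWord (σ ∘σ τ) u
  subst-substWord σ τ []      = pairs-agree λ φ → trans (pair-subst φ σ (substWord τ []))
    (trans (+-cong (*-identityˡ _) refl) (+-identityʳ _))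
  subst-substWord σ τ (i ∷ u) = ≋-trans (subst-* σ (τ i) (substWord τ u))
    (*-≋ {p = subst σ (τ i)} ≋-refl (subst-substWord σ τ u))

  subst-subst : ∀ σ τ b → subst σ (subst τ b) ≋ subst (σ ∘σ τ) b
  subst-subst σ τ b = pairs-agree λ φ → begin
    pair φ (subst σ (subst τ b))                             ≈⟨ pair-subst φ σ (subst τ b) ⟩
    pair (λ w → pair φ (substWord σ w)) (subst τ b)          ≈⟨ pair-subst _ τ b ⟩
    pair (λ u → pair (λ w → pair φ (substWord σ w)) (substWord τ u)) b
      ≈⟨ pair-congˡ b (λ u → sym (pair-subst φ σ (substWord τ u))) ⟩
    pair (λ u → pair φ (subst σ (substWord τ u))) b
      ≈⟨ pair-congˡ b (λ u → pair-≈ (subst-substWord σ τ u) φ) ⟩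
    pair (λ u → pair φ (substWord (σ ∘σ τ) u)) b              ≈⟨ sym (pair-subst φ (σ ∘σ τ) b) ⟩
    pair φ (subst (σ ∘σ τ) b)                                ∎

  substInstance-subst : ∀ {B h} σ → SubstInstance B h → SubstInstance B (subst σ h)
  substInstance-subst {h = h} σ (b , b∈B , τ , h≈τb) = b , b∈B , σ ∘σ τ ,
    ≋⇒≈P (≋-trans (subst-≋ σ (≈P⇒≋ {h} {subst τ b} h≈τb)) (subst-subst σ τ b))

module Ideals {c ℓ} (F : Field c ℓ) where
  open FreeAlgebra F
  open Pairing F
  open Operations F

  Term : Set c
  Term = Poly × Poly × Poly

  termsSum : List Term → Poly
  termsSum []                  = []
  termsSum ((l , g , r) ∷ ts) = l *P g *P r ++ termsSum ts

  infix 4 _∈⟨_⟩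
  record _∈⟨_⟩ (f : Poly) (H : List Poly) : Set (c ⊔ ℓ) where
    constructor decomposition
    field
      terms       : List Term
      generators  : All (λ t → proj₁ (proj₂ t) ∈ H) terms
      f≋termsSum  : f ≋ termsSum terms

  ∈⟨⟩-resp-≋ : ∀ {H f f′} → f ≋ f′ → f ∈⟨ H ⟩ → f′ ∈⟨ H ⟩
  ∈⟨⟩-resp-≋ f≋f′ (decomposition ts gens eq) = decomposition ts gens (≋-trans (≋-sym f≋f′) eq)

  ∈⟨⟩-mono : ∀ {H H′ f} → (∀ {g} → g ∈ H → g ∈ H′) → f ∈⟨ H ⟩ → f ∈⟨ H′ ⟩
  ∈⟨⟩-mono H⊆H′ (decomposition ts gens eq) = decomposition ts (All.map H⊆H′ gens) eq

  zero∈⟨⟩ : ∀ {H} → [] ∈⟨ H ⟩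
  zero∈⟨⟩ = decomposition [] [] ≋-refl

  termsSum-++ : ∀ ts ts′ → termsSum ts ++ termsSum ts′ ≡.≡ termsSum (ts ++ ts′)
  termsSum-++ []                  ts′ = ≡.refl
  termsSum-++ ((l , g , r) ∷ ts) ts′ = ≡.trans (++-assoc (l *P g *P r) (termsSum ts) (termsSum ts′))
    (≡.cong (l *P g *P r ++_) (termsSum-++ ts ts′))

  ++-∈⟨⟩ : ∀ {H f f′} → f ∈⟨ H ⟩ → f′ ∈⟨ H ⟩ → f ++ f′ ∈⟨ H ⟩
  ++-∈⟨⟩ (decomposition ts gens eq) (decomposition ts′ gens′ eq′) =
    decomposition (ts ++ ts′) (++⁺ gens gens′)
      (≋-trans (++-≋ eq eq′) (≋-reflexive (termsSum-++ ts ts′)))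

  generator∈⟨⟩ : ∀ {H g} l r → g ∈ H → l *P g *P r ∈⟨ H ⟩
  generator∈⟨⟩ {g = g} l r g∈H =
    decomposition ((l , g , r) ∷ []) (g∈H ∷ []) (≋-reflexive (≡.sym (++-identityʳ _)))

  reassociate : ∀ l l′ g r′ r → l *P (l′ *P g *P r′) *P r ≋ (l *P l′) *P g *P (r′ *P r)
  reassociate l l′ g r′ r =
    ≋-trans (*-≋ {q = r} (≋-sym (*-assoc-≋ l (l′ *P g) r′)) ≋-refl)
    (≋-trans (*-assoc-≋ (l *P (l′ *P g)) r′ r)
    (*-≋ {q = r′ *P r} (≋-sym (*-assoc-≋ l l′ g)) ≋-refl))

  mult-∈⟨⟩ : ∀ {H f} l r → f ∈⟨ H ⟩ → l *P f *P r ∈⟨ H ⟩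
  mult-∈⟨⟩ {H} l r (decomposition ts gens eq) =
    ∈⟨⟩-resp-≋ (*-≋ {q = r} (*-≋ {p = l} ≋-refl (≋-sym eq)) ≋-refl) (sum∈⟨⟩ ts gens)
    where
    sum∈⟨⟩ : ∀ ts → All (λ t → proj₁ (proj₂ t) ∈ H) ts → l *P termsSum ts *P r ∈⟨ H ⟩
    sum∈⟨⟩ [] [] = ∈⟨⟩-resp-≋ (≋-sym (*-≋ {q = r} (*-zeroʳ-≋ l) ≋-refl)) zero∈⟨⟩
    sum∈⟨⟩ ((l′ , g , r′) ∷ ts) (g∈H ∷ gens) =
      ∈⟨⟩-resp-≋ (≋-sym (≋-trans (*-≋ {q = r} (*-distribˡ-≋ l (l′ *P g *P r′) (termsSum ts)) ≋-refl)
                                  (*-distribʳ-≋ (l *P (l′ *P g *P r′)) (l *P termsSum ts) r)))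
        (++-∈⟨⟩ (∈⟨⟩-resp-≋ (≋-sym (reassociate l l′ g r′ r)) (generator∈⟨⟩ (l *P l′) (r′ *P r) g∈H))
                (sum∈⟨⟩ ts gens))

  ∈⟨⟩-trans : ∀ {H H′ f} → f ∈⟨ H ⟩ → (∀ {g} → g ∈ H → g ∈⟨ H′ ⟩) → f ∈⟨ H′ ⟩
  ∈⟨⟩-trans {H} {H′} (decomposition ts gens eq) H⊆⟨H′⟩ = ∈⟨⟩-resp-≋ (≋-sym eq) (sum∈⟨⟩ ts gens)
    where
    sum∈⟨⟩ : ∀ ts → All (λ t → proj₁ (proj₂ t) ∈ H) ts → termsSum ts ∈⟨ H′ ⟩
    sum∈⟨⟩ []                  []            = zero∈⟨⟩
    sum∈⟨⟩ ((l , g , r) ∷ ts) (g∈H ∷ gens) = ++-∈⟨⟩ (mult-∈⟨⟩ l r (H⊆⟨H′⟩ g∈H)) (sum∈⟨⟩ ts gens)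

  subst-∈⟨⟩ : ∀ {H f} σ → f ∈⟨ H ⟩ → subst σ f ∈⟨ map (subst σ) H ⟩
  subst-∈⟨⟩ {H} σ (decomposition ts gens eq) = ∈⟨⟩-resp-≋ (≋-sym (subst-≋ σ eq)) (sum∈⟨⟩ ts gens)
    where
    sum∈⟨⟩ : ∀ ts → All (λ t → proj₁ (proj₂ t) ∈ H) ts → subst σ (termsSum ts) ∈⟨ map (subst σ) H ⟩
    sum∈⟨⟩ []                  []            = zero∈⟨⟩
    sum∈⟨⟩ ((l , g , r) ∷ ts) (g∈H ∷ gens) =
      ∈⟨⟩-resp-≋ (≋-sym (≋-trans (subst-++ σ (l *P g *P r) (termsSum ts))
          (++-≋ (≋-trans (subst-* σ (l *P g) r) (*-≋ {q = subst σ r} (subst-* σ l g) ≋-refl)) ≋-refl)))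
        (++-∈⟨⟩ (generator∈⟨⟩ (subst σ l) (subst σ r) (∈-map⁺ (subst σ) g∈H)) (sum∈⟨⟩ ts gens))

  inIdeal⇒∈⟨⟩ : ∀ {k} (gs : Fin k → Poly) f → InIdeal gs f → f ∈⟨ tabulate gs ⟩
  inIdeal⇒∈⟨⟩ {k} gs f (ts , f≈) = ∈⟨⟩-resp-≋ (≋-sym (≈P⇒≋ {f} {sumP (map term ts)} f≈)) (sum∈⟨⟩ ts)
    where
    term : Poly × Fin k × Poly → Poly
    term (l , i , r) = l *P gs i *P r
    sum∈⟨⟩ : ∀ ts → sumP (map term ts) ∈⟨ tabulate gs ⟩
    sum∈⟨⟩ []                  = zero∈⟨⟩
    sum∈⟨⟩ ((l , i , r) ∷ ts) = ++-∈⟨⟩ (generator∈⟨⟩ l r (∈-tabulate⁺ i)) (sum∈⟨⟩ ts)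

  ∈⟨⟩⇒inIdeal : ∀ H f → f ∈⟨ H ⟩ → InIdeal (lookup H) f
  ∈⟨⟩⇒inIdeal H f (decomposition ts gens eq) = indexed ts gens f eq
    where
    term : Poly × Fin (length H) × Poly → Poly
    term (l , i , r) = l *P lookup H i *P r
    indexed : ∀ ts → All (λ t → proj₁ (proj₂ t) ∈ H) ts → ∀ f → f ≋ termsSum ts → InIdeal (lookup H) f
    indexed []                  []            f eq = [] , ≋⇒≈P eq
    indexed ((l , g , r) ∷ ts) (g∈H ∷ gens) f eq with indexed ts gens (termsSum ts) ≋-refl
    ... | its , ts≈ = (l , index g∈H , r) ∷ its ,
      ≋⇒≈P {f} {sumP (map term ((l , index g∈H , r) ∷ its))}
        (≋-trans eq (++-≋ (≋-reflexive (≡.cong (λ g → l *P g *P r) (lookup-index g∈H)))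
                          (≈P⇒≋ {termsSum ts} {sumP (map term its)} ts≈)))

  ∈⟨⟩⇒generatedBy : ∀ {B H f} → All (SubstInstance B) H → f ∈⟨ H ⟩ → GeneratedBy B f (length H)
  ∈⟨⟩⇒generatedBy {H = H} {f} H-inst f∈⟨H⟩ =
    lookup H , (λ i → All.lookup H-inst (∈-lookup i)) , ∈⟨⟩⇒inIdeal H f f∈⟨H⟩

open import Data.Nat using (_≤_; _*_)

module Counting {c ℓ} (F : Field c ℓ) where
  open FreeAlgebra F
  open Pairing F using (≋-sym; ≈P⇒≋)
  open Operations F using (substInstance-subst)
  open Ideals F

  commonGenerators : ∀ {B₀} B → All (λ b → ∃ (GeneratedBy B₀ b)) B →
    Σ (List Poly) λ H → All (SubstInstance B₀) H × (∀ {b} → b ∈ B → b ∈⟨ H ⟩)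
  commonGenerators []      []                                       = [] , [] , λ ()
  commonGenerators (b ∷ B) ((_ , gs , gs-inst , b∈⟨gs⟩) ∷ B-gen) with commonGenerators B B-gen
  ... | H , H-inst , B⊆⟨H⟩ =
    tabulate gs ++ H , ++⁺ (tabulate⁺ gs-inst) H-inst ,
    λ { (Any.here ≡.refl) → ∈⟨⟩-mono ∈-++⁺ˡ (inIdeal⇒∈⟨⟩ gs b b∈⟨gs⟩)
      ; (Any.there b∈B)   → ∈⟨⟩-mono (∈-++⁺ʳ (tabulate gs)) (B⊆⟨H⟩ b∈B) }

  substitution : ∀ {B g} → SubstInstance B g → ℕ → Poly
  substitution (_ , _ , σ , _) = σ

  instance∈⟨σH⟩ : ∀ {B H g} → (∀ {b} → b ∈ B → b ∈⟨ H ⟩) →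
    (inst : SubstInstance B g) → g ∈⟨ map (subst (substitution {B} {g} inst)) H ⟩
  instance∈⟨σH⟩ {g = g} B⊆⟨H⟩ (b , b∈B , σ , g≈σb) =
    ∈⟨⟩-resp-≋ (≋-sym (≈P⇒≋ {g} {subst σ b} g≈σb)) (subst-∈⟨⟩ σ (B⊆⟨H⟩ b∈B))

  substitutedCopies : List Poly → ∀ n → (Fin n → ℕ → Poly) → List Poly
  substitutedCopies H zero    σs = []
  substitutedCopies H (suc n) σs =
    map (subst (σs Fin.zero)) H ++ substitutedCopies H n (λ i → σs (Fin.suc i))

  length-substitutedCopies : ∀ H n σs → length (substitutedCopies H n σs) ≡.≡ n * length H
  length-substitutedCopies H zero    σs = ≡.refl
  length-substitutedCopies H (suc n) σs = ≡.trans (length-++ (map (subst (σs Fin.zero)) H))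
    (≡.cong₂ ℕ._+_ (length-map (subst (σs Fin.zero)) H)
                   (length-substitutedCopies H n (λ i → σs (Fin.suc i))))

  copy⊆substitutedCopies : ∀ H n σs i {g} → g ∈ map (subst (σs i)) H → g ∈ substitutedCopies H n σs
  copy⊆substitutedCopies H (suc n) σs Fin.zero    g∈copy = ∈-++⁺ˡ g∈copy
  copy⊆substitutedCopies H (suc n) σs (Fin.suc i) g∈copy = ∈-++⁺ʳ (map (subst (σs Fin.zero)) H)
    (copy⊆substitutedCopies H n (λ j → σs (Fin.suc j)) i g∈copy)

  substitutedCopies-instances : ∀ {B} H n σs → All (SubstInstance B) H →
    All (SubstInstance B) (substitutedCopies H n σs)
  substitutedCopies-instances     H zero    σs H-inst = []
  substitutedCopies-instances {B} H (suc n) σs H-inst =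
    ++⁺ (map⁺ (All.map (λ {h} → substInstance-subst {B} {h} (σs Fin.zero)) H-inst))
        (substitutedCopies-instances H n (λ i → σs (Fin.suc i)) H-inst)

  generatedBy-transfer : ∀ {B₀ B₁ H f q} → All (SubstInstance B₀) H →
    (∀ {b} → b ∈ B₁ → b ∈⟨ H ⟩) → GeneratedBy B₁ f q → GeneratedBy B₀ f (q * length H)
  generatedBy-transfer {B₀} {B₁} {H} {f} {q} H-inst B₁⊆⟨H⟩ (gs , gs-inst , f∈⟨gs⟩) =
    ≡.subst (GeneratedBy B₀ f) (length-substitutedCopies H q σs)
      (∈⟨⟩⇒generatedBy (substitutedCopies-instances H q σs H-inst)
        (∈⟨⟩-trans (inIdeal⇒∈⟨⟩ gs f f∈⟨gs⟩) gs⊆⟨copies⟩))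
    where
    σs : Fin q → ℕ → Poly
    σs i = substitution {B₁} {gs i} (gs-inst i)
    gs⊆⟨copies⟩ : ∀ {g} → g ∈ tabulate gs → g ∈⟨ substitutedCopies H q σs ⟩
    gs⊆⟨copies⟩ g∈gs with ∈-tabulate⁻ g∈gs
    ... | i , ≡.refl = ∈⟨⟩-mono (copy⊆substitutedCopies H q σs i) (instance∈⟨σH⟩ B₁⊆⟨H⟩ (gs-inst i))

  Q-least : ∀ {B f q k} → Q_≡ B f q → GeneratedBy B f k → q ≤ k
  Q-least (_ , minimal) f-generated = ℕP.≮⇒≥ (λ k<q → minimal _ k<q f-generated)

  Q-bound : ∀ {B₀ B₁} → All (λ b → ∃ (GeneratedBy B₀ b)) B₁ →
    Σ ℕ λ C → ∀ f q₀ q₁ → Q_≡ B₀ f q₀ → GeneratedBy B₁ f q₁ → q₀ ≤ C * q₁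
  Q-bound {B₀} {B₁} B₁-generated with commonGenerators B₁ B₁-generated
  ... | H , H-inst , B₁⊆⟨H⟩ = length H , λ f q₀ q₁ Q₀ f-generated₁ →
    ℕP.≤-trans (Q-least {B₀} {f} Q₀ (generatedBy-transfer {B₀} {B₁} {H} {f} H-inst B₁⊆⟨H⟩ f-generated₁))
               (ℕP.≤-reflexive (ℕP.*-comm q₁ (length H)))

-- Every element of the basis B₁ is an identity, hence generated by B₀.
mainTheorem4 : ∀ {c ℓ a ℓa} (F : Field c ℓ) (A : FAlgebra F a ℓa)
    (B₀ B₁ : List (FreeAlgebra.Poly F)) →
    FreeAlgebra.IsBasis F A B₀ → FreeAlgebra.IsBasis F A B₁ →
    Σ ℕ λ C → ∀ f → FreeAlgebra.IsIdentity F A f →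
      ∀ q₀ q₁ → FreeAlgebra.Q_≡ F B₀ f q₀ → FreeAlgebra.Q_≡ F B₁ f q₁ →
      q₀ ≤ C * q₁
mainTheorem4 F A B₀ B₁ (_ , identities-generated₀) (identities₁ , _)
  with Counting.Q-bound F {B₀} {B₁} (All.map (λ {b} → identities-generated₀ b) identities₁)
... | C , bound = C , λ f _ q₀ q₁ Q₀ Q₁ → bound f q₀ q₁ Q₀ (proj₁ Q₁)
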